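{- Let $r,s$ be coprime positive integers. The generating function $\delta^{r/s}(x)=\sum_{n\ge 0}|R_n^{r/s}|\,x^n$ of the rational Dyck paths $\mathcal R^{r/s}=\bigcup_{n\ge0}R_n^{r/s}$, counted by semilength, is $$ \delta^{r/s}(x)=\frac{1-x^{r+s}-\sum_{k=1}^{r} x^{k+\lceil ks/r\rceil}}{(1-x)(1-x^{r+s})-\sum_{k=1}^{r} x^{k+\lceil ks/r\rceil}} =\frac{1-\sum_{k=1}^{r-1} x^{k+\lceil ks/r\rceil}-2x^{r+s}}{1-x-\sum_{k=1}^{r-1} x^{k+\lceil ks/r\rceil}-2x^{r+s}+x^{r+s+1}}. $$
   Context: Let $\mathcal D$ be the set of Dyck paths of height at most $2$: words over $\{U,D\}$ ($U=(1,1)$, $D=(1,-1)$) from $(0,0)$ to $(2n,0)$ never going below the $x$-axis and whose $U$ steps reach ordinate at most $2$; $n$ is the semilength, and the empty path $\varepsilon$ has semilength $0$. Every nonempty $P\in\mathcal D$ has the form $UwD$ where $w$ is a word in the factors $UD$ and $DU$; grouping $w$ into maximal runs gives the factorization $P=U(UD)^{p_1}(DU)^{v_1}(UD)^{p_2}(DU)^{v_2}\cdots(UD)^{p_k}(DU)^{v_k}D$, where $p_1\ge0$ and $v_k\ge0$ may be zero and all other exponents are positive; for $P=UD$ one has $k=0$. For coprime positive integers $r,s$, $R_n^{r/s}$ is the set of paths $P\in\mathcal D$ of semilength $n$ such that $v_i\ge\lceil p_i s/r\rceil$ for every $i=1,\dots,k$ (so $R_0^{r/s}=\{\varepsilon\}$).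 -}

module Defs where

open import Data.Bool using (Bool; true; false; _∧_; if_then_else_)
open import Data.Nat using (ℕ; zero; suc; _+_; _*_; _∸_; _≤ᵇ_; _<ᵇ_; _≡ᵇ_; _/_)
open import Data.Integer as ℤ using (ℤ; +_; -_)
open import Data.List using (List; []; _∷_; _++_; map; concatMap; length; filterᵇ; upTo)
open import Data.Maybe using (Maybe; just; nothing)
open import Data.Product using (_×_; _,_)

data Step : Set where
  U D : Step

words : ℕ → List (List Step)
words zero    = [] ∷ []
words (suc m) = concatMap (λ w → (U ∷ w) ∷ (D ∷ w) ∷ []) (words m)

dyck2From : ℕ → List Step → Bool
dyck2From h       []      = h ≡ᵇ 0
dyck2From h       (U ∷ w) = if h <ᵇ 2 then dyck2From (suc h) w else false
dyck2From zero    (D ∷ w) = false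
dyck2From (suc h) (D ∷ w) = dyck2From h w

isDyck2 : List Step → Bool
isDyck2 = dyck2From 0

-- Factorization  P = U w D, w a word in the factors UD (true) and DU (false)

-- given the suffix  w D  (P with its first U removed), read w as a list
-- of factors UD (true) / DU (false)
factors : List Step → Maybe (List Bool)
factors (D ∷ [])    = just []
factors (U ∷ D ∷ t) = Data.Maybe.map (true ∷_) (factors t)
factors (D ∷ U ∷ t) = Data.Maybe.map (false ∷_) (factors t)
factors _           = nothing

-- maximal runs: (UD)^{p1}(DU)^{v1}...(UD)^{pk}(DU)^{vk}, returned as the
-- list [(p1,v1),...,(pk,vk)] (p1 and vk may be 0, others positive)
runs : List Bool → List (ℕ × ℕ)
runs []          = []
runs (true ∷ t)  with runs t
... | []             = (1 , 0) ∷ []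
... | (p , v) ∷ bs   = (suc p , v) ∷ bs
runs (false ∷ t) with runs t
... | []             = (0 , 1) ∷ []
... | (zero , v) ∷ bs  = (0 , suc v) ∷ bs
... | (suc p , v) ∷ bs = (0 , 1) ∷ (suc p , v) ∷ bs

-- ⌈ a / b ⌉ for b > 0 (value for b = 0 is irrelevant)
ceilDiv : ℕ → ℕ → ℕ
ceilDiv a zero    = 0
ceilDiv a (suc b) = (a + b) / suc b

runsOK : ℕ → ℕ → List (ℕ × ℕ) → Bool
runsOK r s []             = true
runsOK r s ((p , v) ∷ bs) = (ceilDiv (p * s) r ≤ᵇ v) ∧ runsOK r s bs

factorOK : ℕ → ℕ → List Step → Bool
factorOK r s []      = true
factorOK r s (D ∷ w) = false
factorOK r s (U ∷ w) with factors w
... | nothing = false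
... | just fs = runsOK r s (runs fs)

inR : ℕ → ℕ → List Step → Bool
inR r s P = isDyck2 P ∧ factorOK r s P

countR : ℕ → ℕ → ℕ → ℕ
countR r s n = length (filterᵇ (inR r s) (words (2 * n)))

-- Polynomials with integer coefficients as lists of terms  c·x^e

Poly : Set
Poly = List (ℤ × ℕ)

polyCoeff : Poly → ℕ → ℤ
polyCoeff []            n = + 0
polyCoeff ((c , e) ∷ P) n = (if e ≡ᵇ n then c else + 0) ℤ.+ polyCoeff P n

polyNeg : Poly → Poly
polyNeg = map (λ { (c , e) → (- c , e) })

polyMul : Poly → Poly → Poly
polyMul P Q = concatMap (λ { (c , e) → map (λ { (d , f) → (c ℤ.* d , e + f) }) Q }) P

-- coefficient of x^n in  P(x) · Σ_m f(m) x^m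
mulSeriesCoeff : Poly → (ℕ → ℤ) → ℕ → ℤ
mulSeriesCoeff []            f n = + 0
mulSeriesCoeff ((c , e) ∷ P) f n =
  (if e ≤ᵇ n then c ℤ.* f (n ∸ e) else + 0) ℤ.+ mulSeriesCoeff P f n

sumTerms : ℕ → ℕ → ℕ → Poly
sumTerms r s m = map (λ k → (+ 1 , k + ceilDiv (k * s) r)) (map suc (upTo m))

num1 : ℕ → ℕ → Poly
num1 r s = (+ 1 , 0) ∷ (- + 1 , r + s) ∷ polyNeg (sumTerms r s r)

den1 : ℕ → ℕ → Poly
den1 r s = polyMul ((+ 1 , 0) ∷ (- + 1 , 1) ∷ []) ((+ 1 , 0) ∷ (- + 1 , r + s) ∷ [])
           ++ polyNeg (sumTerms r s r)

num2 : ℕ → ℕ → Poly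
num2 r s = (+ 1 , 0) ∷ (- + 2 , r + s) ∷ polyNeg (sumTerms r s (r ∸ 1))

den2 : ℕ → ℕ → Poly
den2 r s = (+ 1 , 0) ∷ (- + 1 , 1) ∷ (- + 2 , r + s) ∷ (+ 1 , r + s + 1)
           ∷ polyNeg (sumTerms r s (r ∸ 1))

module Submission where

open import Defs
open import Data.Bool using (Bool; true; false; _∧_; if_then_else_)
open import Data.Bool.Properties using (∧-zeroʳ; ∧-identityʳ)
open import Data.Nat using (ℕ; zero; suc; _+_; _*_; _∸_; _≤_; _<_; _≤ᵇ_; _<ᵇ_; _≡ᵇ_; s≤s; z≤n; _<?_)
open import Data.Nat.Properties
open import Data.Nat.DivMod using (_/_; m<n⇒m/n≡0; m≥n⇒m/n>0; /-monoˡ-≤; +-distrib-/-∣ʳ; m*n/n≡m)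
open import Data.Nat.Divisibility using (divides)
open import Data.Nat.Coprimality using (Coprime)
open import Data.Nat.Tactic.RingSolver as ℕ-Solver using ()
open import Data.Integer using (ℤ; +_; -_) renaming (_+_ to _+ℤ_; _*_ to _*ℤ_; _-_ to _-ℤ_)
import Data.Integer.Properties as ℤ
open import Data.Integer.Tactic.RingSolver as ℤ-Solver using ()
open import Data.List using (List; []; _∷_; _++_; length; filterᵇ; concatMap; map; upTo)
open import Data.List.Properties using (upTo-∷ʳ; map-++)
open import Data.Maybe using (Maybe; just; nothing)
open import Data.Product using (_×_; _,_)
open import Function using (_∘_)
open import Relation.Nullary using (yes; no)
open import Relation.Nullary.Decidable using (dec-true; dec-false)
open import Relation.Binary.PropositionalEquality

-- A path U w D of R^{r/s} is read factor by factor. The only state needed is the pair (p, v) of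
-- lengths of the current UD-run and of the DU-run after it; the DU-run may close only once
-- v ≥ ⌈ps/r⌉, and then the state returns to the start. Let F(x) and G(x) count the completions
-- of the start state and of the state after one UD factor. Then F = 1 + xF + xG, and following G
-- through UD-runs of lengths 1, …, r gives
--   xG = Σ_{k=1}^{r} x^{k+⌈ks/r⌉} F + x^{r+s+1} G,
-- because ⌈(p+r)s/r⌉ = ⌈ps/r⌉ + s makes a UD-run of length p + r behave like one of length p
-- delayed by x^s. Eliminating G gives F ((1-x)(1-x^{r+s}) - Σ_k x^{k+⌈ks/r⌉}) = 1 - x^{r+s},
-- and δ^{r/s} = 1 + xF yields the first form. The second is the same fraction, since the k = r
-- term of the sum is x^{r+s}.

indicator : Bool → ℕ
indicator true  = 1
indicator false = 0

countIn : (List Step → Bool) → List (List Step) → ℕ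
countIn p ws = length (filterᵇ p ws)

count : (List Step → Bool) → ℕ → ℕ
count p m = countIn p (words m)

countIn-∷ : ∀ p w ws → countIn p (w ∷ ws) ≡ indicator (p w) + countIn p ws
countIn-∷ p w ws with p w
... | true  = refl
... | false = refl

countIn-cong : ∀ {p q} → (∀ w → p w ≡ q w) → ∀ ws → countIn p ws ≡ countIn q ws
countIn-cong p≗q []       = refl
countIn-cong {p} {q} p≗q (w ∷ ws) = begin
  countIn p (w ∷ ws)             ≡⟨ countIn-∷ p w ws ⟩
  indicator (p w) + countIn p ws ≡⟨ cong₂ _+_ (cong indicator (p≗q w)) (countIn-cong p≗q ws) ⟩
  indicator (q w) + countIn q ws ≡⟨ countIn-∷ q w ws ⟨
  countIn q (w ∷ ws)             ∎
  where open ≡-Reasoning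

countIn-prefixes : ∀ p ws →
  countIn p (concatMap (λ w → (U ∷ w) ∷ (D ∷ w) ∷ []) ws)
    ≡ countIn (p ∘ (U ∷_)) ws + countIn (p ∘ (D ∷_)) ws
countIn-prefixes p []       = refl
countIn-prefixes p (w ∷ ws) = begin
  countIn p ((U ∷ w) ∷ (D ∷ w) ∷ rest)
    ≡⟨ countIn-∷ p (U ∷ w) _ ⟩
  u + countIn p ((D ∷ w) ∷ rest)
    ≡⟨ cong (λ k → u + k) (countIn-∷ p (D ∷ w) rest) ⟩
  u + (d + countIn p rest)
    ≡⟨ cong (λ k → u + (d + k)) (countIn-prefixes p ws) ⟩
  u + (d + (countIn (p ∘ (U ∷_)) ws + countIn (p ∘ (D ∷_)) ws))
    ≡⟨ interchange u d _ _ ⟩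
  (u + countIn (p ∘ (U ∷_)) ws) + (d + countIn (p ∘ (D ∷_)) ws)
    ≡⟨ cong₂ _+_ (countIn-∷ (p ∘ (U ∷_)) w ws) (countIn-∷ (p ∘ (D ∷_)) w ws) ⟨
  countIn (p ∘ (U ∷_)) (w ∷ ws) + countIn (p ∘ (D ∷_)) (w ∷ ws)
    ∎
  where
  open ≡-Reasoning
  rest = concatMap (λ w → (U ∷ w) ∷ (D ∷ w) ∷ []) ws
  u = indicator (p (U ∷ w))
  d = indicator (p (D ∷ w))
  interchange : ∀ a b x y → a + (b + (x + y)) ≡ (a + x) + (b + y)
  interchange = ℕ-Solver.solve-∀

count-cong : ∀ {p q} → (∀ w → p w ≡ q w) → ∀ m → count p m ≡ count q m
count-cong p≗q m = countIn-cong p≗q (words m)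

count-suc : ∀ p m → count p (suc m) ≡ count (p ∘ (U ∷_)) m + count (p ∘ (D ∷_)) m
count-suc p m = countIn-prefixes p (words m)

count-zero : ∀ p → count p 0 ≡ indicator (p [])
count-zero p = trans (countIn-∷ p [] []) (+-identityʳ _)

count-false : ∀ m → count (λ _ → false) m ≡ 0
count-false m = go (words m)
  where
  go : ∀ ws → countIn (λ _ → false) ws ≡ 0
  go []       = refl
  go (_ ∷ ws) = go ws

count-∧ : ∀ b p m → count (λ w → b ∧ p w) m ≡ (if b then count p m else 0)
count-∧ true  p m = refl
count-∧ false p m = count-false m

-- The run list of (UD)^p (DU)^v followed by a factor word whose run list is the argument.
prependRun : ℕ → ℕ → List (ℕ × ℕ) → List (ℕ × ℕ)
prependRun p v       []                    = (p , v) ∷ []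
prependRun p zero    ((a , b) ∷ bs)        = (p + a , b) ∷ bs
prependRun p (suc v) ((zero , b) ∷ bs)     = (p , suc v + b) ∷ bs
prependRun p (suc v) ((suc a , b) ∷ bs)    = (p , suc v) ∷ (suc a , b) ∷ bs

runs-UD : ∀ fs → runs (true ∷ fs) ≡ prependRun 1 0 (runs fs)
runs-UD fs with runs fs
... | []     = refl
... | _ ∷ _  = refl

runs-DU : ∀ fs → runs (false ∷ fs) ≡ prependRun 0 1 (runs fs)
runs-DU fs with runs fs
... | []              = refl
... | (zero , _) ∷ _  = refl
... | (suc _ , _) ∷ _ = refl

prependRun-UD : ∀ p q v L → prependRun p 0 (prependRun q v L) ≡ prependRun (p + q) v L
prependRun-UD p q v       []                 = refl
prependRun-UD p q zero    ((a , b) ∷ bs)     = cong (λ x → (x , b) ∷ bs) (sym (+-assoc p q a))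
prependRun-UD p q (suc v) ((zero , b) ∷ bs)  = refl
prependRun-UD p q (suc v) ((suc a , b) ∷ bs) = refl

prependRun-DU : ∀ p v L → prependRun p v (prependRun 0 1 L) ≡ prependRun p (suc v) L
prependRun-DU p zero    []                 = cong (λ x → (x , 1) ∷ []) (+-identityʳ p)
prependRun-DU p (suc v) []                 = cong (λ x → (p , suc x) ∷ []) (+-comm v 1)
prependRun-DU p zero    ((zero , b) ∷ bs)  = cong (λ x → (x , suc b) ∷ bs) (+-identityʳ p)
prependRun-DU p (suc v) ((zero , b) ∷ bs)  = cong (λ x → (p , suc x) ∷ bs) (+-suc v b)
prependRun-DU p zero    ((suc a , b) ∷ bs) = cong (λ x → (x , 1) ∷ (suc a , b) ∷ bs) (+-identityʳ p)
prependRun-DU p (suc v) ((suc a , b) ∷ bs) = cong (λ x → (p , suc x) ∷ (suc a , b) ∷ bs) (+-comm v 1)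

prependRun-closes : ∀ p v q w L →
  prependRun p (suc v) (prependRun (suc q) w L) ≡ (p , suc v) ∷ prependRun (suc q) w L
prependRun-closes p v q w       []                 = refl
prependRun-closes p v q zero    ((a , b) ∷ bs)     = refl
prependRun-closes p v q (suc w) ((zero , b) ∷ bs)  = refl
prependRun-closes p v q (suc w) ((suc a , b) ∷ bs) = refl

factors-dyck2 : ∀ w {fs} → factors w ≡ just fs → dyck2From 1 w ≡ true
factors-dyck2 (D ∷ [])    _  = refl
factors-dyck2 (U ∷ D ∷ t) eq with factors t in eqt
... | just _ = factors-dyck2 t eqt
factors-dyck2 (D ∷ U ∷ t) eq with factors t in eqt
... | just _ = factors-dyck2 t eqt
factors-dyck2 []          ()
factors-dyck2 (U ∷ [])    ()
factors-dyck2 (U ∷ U ∷ t) ()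
factors-dyck2 (D ∷ D ∷ t) ()

ceilDiv-zero : ∀ b → ceilDiv 0 b ≡ 0
ceilDiv-zero zero    = refl
ceilDiv-zero (suc b) = m<n⇒m/n≡0 (n<1+n b)

ceilDiv-pos : ∀ a b → 0 < ceilDiv (suc a) (suc b)
ceilDiv-pos a b = m≥n⇒m/n>0 (s≤s (m≤n+m b a))

ceilDiv-monoˡ-≤ : ∀ {a a′} b → a ≤ a′ → ceilDiv a b ≤ ceilDiv a′ b
ceilDiv-monoˡ-≤ zero    _    = z≤n
ceilDiv-monoˡ-≤ (suc b) a≤a′ = /-monoˡ-≤ (suc b) (+-monoˡ-≤ b a≤a′)

ceilDiv-+-* : ∀ a k b → ceilDiv (a + k * suc b) (suc b) ≡ ceilDiv a (suc b) + k
ceilDiv-+-* a k b = begin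
  (a + k * suc b + b) / suc b   ≡⟨ cong (_/ suc b) (swap a (k * suc b) b) ⟩
  (a + b + k * suc b) / suc b   ≡⟨ +-distrib-/-∣ʳ (a + b) (divides k refl) ⟩
  (a + b) / suc b + k * suc b / suc b ≡⟨ cong (λ x → (a + b) / suc b + x) (m*n/n≡m k (suc b)) ⟩
  (a + b) / suc b + k           ∎
  where
  open ≡-Reasoning
  swap : ∀ x y z → x + y + z ≡ x + z + y
  swap = ℕ-Solver.solve-∀

ceilDiv-*ˡ : ∀ b k → ceilDiv (suc b * k) (suc b) ≡ k
ceilDiv-*ˡ b k = begin
  ceilDiv (suc b * k) (suc b)      ≡⟨ cong (λ a → ceilDiv a (suc b)) (*-comm (suc b) k) ⟩
  ceilDiv (0 + k * suc b) (suc b)  ≡⟨ ceilDiv-+-* 0 k b ⟩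
  ceilDiv 0 (suc b) + k            ≡⟨ cong (_+ k) (ceilDiv-zero (suc b)) ⟩
  k                                ∎
  where open ≡-Reasoning

odd : ℕ → ℕ
odd zero    = 1
odd (suc j) = suc (suc (odd j))

module Completions (r s : ℕ) where

  meets : ℕ → ℕ → Bool
  meets p v = ceilDiv (p * s) r ≤ᵇ v

  -- Whether the factor word m (nothing if there is none) completes the prefix U (UD)^p (DU)^v.
  admissibleAfter : ℕ → ℕ → Maybe (List Bool) → Bool
  admissibleAfter p v nothing   = false
  admissibleAfter p v (just fs) = runsOK r s (prependRun p v (runs fs))

  admissibleAfter-UD-open : ∀ p m →
    admissibleAfter p 0 (Data.Maybe.map (true ∷_) m) ≡ admissibleAfter (suc p) 0 m
  admissibleAfter-UD-open p nothing   = refl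
  admissibleAfter-UD-open p (just fs) rewrite runs-UD fs | prependRun-UD p 1 0 (runs fs) | +-comm p 1 = refl

  admissibleAfter-UD-close : ∀ p v m →
    admissibleAfter p (suc v) (Data.Maybe.map (true ∷_) m) ≡ meets p (suc v) ∧ admissibleAfter 1 0 m
  admissibleAfter-UD-close p v nothing   = sym (∧-zeroʳ _)
  admissibleAfter-UD-close p v (just fs) rewrite runs-UD fs | prependRun-closes p v 0 0 (runs fs) = refl

  admissibleAfter-DU : ∀ p v m →
    admissibleAfter p v (Data.Maybe.map (false ∷_) m) ≡ admissibleAfter p (suc v) m
  admissibleAfter-DU p v nothing   = refl
  admissibleAfter-DU p v (just fs) rewrite runs-DU fs | prependRun-DU p v (runs fs) = refl

  admissibleAfter-start : ∀ L → runsOK r s (prependRun 0 0 L) ≡ runsOK r s L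
  admissibleAfter-start []            rewrite ceilDiv-zero r = refl
  admissibleAfter-start ((a , b) ∷ bs) = refl

  inR-U : ∀ w → inR r s (U ∷ w) ≡ admissibleAfter 0 0 (factors w)
  inR-U w with factors w in eq
  ... | nothing = ∧-zeroʳ _
  ... | just fs rewrite factors-dyck2 w eq = sym (admissibleAfter-start (runs fs))

  completions : ℕ → ℕ → ℕ → ℕ
  completions p v j = count (admissibleAfter p v ∘ factors) (odd j)

  completions-zero : ∀ p v → completions p v 0 ≡ indicator (meets p v)
  completions-zero p v = begin
    count (admissibleAfter p v ∘ factors) 1   ≡⟨ count-suc (admissibleAfter p v ∘ factors) 0 ⟩
    count (λ _ → false) 0 + count accD 0      ≡⟨ cong (λ k → 0 + k) (count-zero accD) ⟩
    indicator (meets p v ∧ true)              ≡⟨ cong indicator (∧-identityʳ _) ⟩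
    indicator (meets p v)                     ∎
    where
    open ≡-Reasoning
    accD = admissibleAfter p v ∘ factors ∘ (D ∷_)

  completions-suc : ∀ p v j → completions p v (suc j)
    ≡ count (λ t → admissibleAfter p v (factors (U ∷ D ∷ t))) (odd j) + completions p (suc v) j
  completions-suc p v j = begin
    count acc (suc (suc m))
      ≡⟨ count-suc acc (suc m) ⟩
    count (acc ∘ (U ∷_)) (suc m) + count (acc ∘ (D ∷_)) (suc m)
      ≡⟨ cong₂ _+_ (count-suc (acc ∘ (U ∷_)) m) (count-suc (acc ∘ (D ∷_)) m) ⟩
    (count (λ _ → false) m + count (acc ∘ (U ∷_) ∘ (D ∷_)) m)
      + (count (acc ∘ (D ∷_) ∘ (U ∷_)) m + count (λ _ → false) m)
      ≡⟨ cong₂ (λ x y → (x + count (acc ∘ (U ∷_) ∘ (D ∷_)) m) + (count (acc ∘ (D ∷_) ∘ (U ∷_)) m + y))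
               (count-false m) (count-false m) ⟩
    count (acc ∘ (U ∷_) ∘ (D ∷_)) m + (count (acc ∘ (D ∷_) ∘ (U ∷_)) m + 0)
      ≡⟨ cong₂ _+_ refl (trans (+-identityʳ _)
                       (count-cong (λ t → admissibleAfter-DU p v (factors t)) m)) ⟩
    count (acc ∘ (U ∷_) ∘ (D ∷_)) m + completions p (suc v) j
      ∎
    where
    open ≡-Reasoning
    m = odd j
    acc = admissibleAfter p v ∘ factors

  completions-suc-open : ∀ p j →
    completions p 0 (suc j) ≡ completions (suc p) 0 j + completions p 1 j
  completions-suc-open p j =
    trans (completions-suc p 0 j)
          (cong (_+ completions p 1 j)
                (count-cong (λ t → admissibleAfter-UD-open p (factors t)) (odd j)))

  completions-suc-closed : ∀ p v j → completions p (suc v) (suc j)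
    ≡ (if meets p (suc v) then completions 1 0 j else 0) + completions p (suc (suc v)) j
  completions-suc-closed p v j =
    trans (completions-suc p (suc v) j)
          (cong (_+ completions p (suc (suc v)) j)
                (trans (count-cong (λ t → admissibleAfter-UD-close p v (factors t)) (odd j))
                       (count-∧ (meets p (suc v)) (admissibleAfter 1 0 ∘ factors) (odd j))))

shift : ℕ → (ℕ → ℤ) → ℕ → ℤ
shift zero    f n       = f n
shift (suc e) f zero    = + 0
shift (suc e) f (suc n) = shift e f n

shift-cong : ∀ e {f g} → (∀ m → f m ≡ g m) → ∀ n → shift e f n ≡ shift e g n
shift-cong zero    f≗g n       = f≗g n
shift-cong (suc e) f≗g zero    = refl
shift-cong (suc e) f≗g (suc n) = shift-cong e f≗g n

shift-map : ∀ e (h : ℤ → ℤ) → h (+ 0) ≡ + 0 → ∀ f n → shift e (h ∘ f) n ≡ h (shift e f n)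
shift-map zero    h h0 f n       = refl
shift-map (suc e) h h0 f zero    = sym h0
shift-map (suc e) h h0 f (suc n) = shift-map e h h0 f n

shift-zipWith : ∀ e (_∙_ : ℤ → ℤ → ℤ) → (+ 0) ∙ (+ 0) ≡ + 0 →
  ∀ f g n → shift e (λ m → f m ∙ g m) n ≡ shift e f n ∙ shift e g n
shift-zipWith zero    _∙_ 0∙0 f g n       = refl
shift-zipWith (suc e) _∙_ 0∙0 f g zero    = sym 0∙0
shift-zipWith (suc e) _∙_ 0∙0 f g (suc n) = shift-zipWith e _∙_ 0∙0 f g n

shift-+ : ∀ e f g n → shift e (λ m → f m +ℤ g m) n ≡ shift e f n +ℤ shift e g n
shift-+ e = shift-zipWith e _+ℤ_ refl

shift-shift : ∀ a b f n → shift a (shift b f) n ≡ shift (a + b) f n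
shift-shift zero    b f n       = refl
shift-shift (suc a) b f zero    = refl
shift-shift (suc a) b f (suc n) = shift-shift a b f n

shift-comm : ∀ a b f n → shift a (shift b f) n ≡ shift b (shift a f) n
shift-comm a b f n = begin
  shift a (shift b f) n ≡⟨ shift-shift a b f n ⟩
  shift (a + b) f n     ≡⟨ cong (λ e → shift e f n) (+-comm a b) ⟩
  shift (b + a) f n     ≡⟨ shift-shift b a f n ⟨
  shift b (shift a f) n ∎
  where open ≡-Reasoning

shift-below : ∀ e f {n} → n < e → shift e f n ≡ + 0
shift-below (suc e) f {zero}  _         = refl
shift-below (suc e) f {suc n} (s≤s n<e) = shift-below e f n<e

shift-suc : ∀ e f n → 0 < e → shift e f (suc n) ≡ shift (e ∸ 1) f n
shift-suc (suc e) f n _ = refl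

shift-+ʳ : ∀ k e f n → shift (e + k) f (n + k) ≡ shift e f n
shift-+ʳ k e f n = begin
  shift (e + k) f (n + k) ≡⟨ cong₂ (λ x y → shift x f y) (+-comm e k) (+-comm n k) ⟩
  shift (k + e) f (k + n) ≡⟨ cancel k ⟩
  shift e f n             ∎
  where
  open ≡-Reasoning
  cancel : ∀ k → shift (k + e) f (k + n) ≡ shift e f n
  cancel zero    = refl
  cancel (suc k) = cancel k

δ : ℕ → ℤ
δ zero    = + 1
δ (suc n) = + 0

<ᵇ-suc : ∀ e n → (e <ᵇ suc n) ≡ (e ≤ᵇ n)
<ᵇ-suc zero    n = refl
<ᵇ-suc (suc e) n = refl

mulSeriesCoeff-∷ : ∀ c e P f n →
  mulSeriesCoeff ((c , e) ∷ P) f n ≡ c *ℤ shift e f n +ℤ mulSeriesCoeff P f n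
mulSeriesCoeff-∷ c e P f n = cong (_+ℤ mulSeriesCoeff P f n) (term e n)
  where
  term : ∀ e n → (if e ≤ᵇ n then c *ℤ f (n ∸ e) else + 0) ≡ c *ℤ shift e f n
  term zero    n       = refl
  term (suc e) zero    = sym (ℤ.*-zeroʳ c)
  term (suc e) (suc n) rewrite <ᵇ-suc e n = term e n

mulSeriesCoeff-cong : ∀ P {f g} → (∀ m → f m ≡ g m) →
  ∀ n → mulSeriesCoeff P f n ≡ mulSeriesCoeff P g n
mulSeriesCoeff-cong []            f≗g n = refl
mulSeriesCoeff-cong ((c , e) ∷ P) f≗g n =
  cong₂ _+ℤ_ (cong (λ x → if e ≤ᵇ n then c *ℤ x else + 0) (f≗g (n ∸ e)))
             (mulSeriesCoeff-cong P f≗g n)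

mulSeriesCoeff-++ : ∀ P Q f n → mulSeriesCoeff (P ++ Q) f n ≡ mulSeriesCoeff P f n +ℤ mulSeriesCoeff Q f n
mulSeriesCoeff-++ []            Q f n = sym (ℤ.+-identityˡ _)
mulSeriesCoeff-++ ((c , e) ∷ P) Q f n =
  trans (cong (t +ℤ_) (mulSeriesCoeff-++ P Q f n))
        (sym (ℤ.+-assoc t (mulSeriesCoeff P f n) (mulSeriesCoeff Q f n)))
  where t = if e ≤ᵇ n then c *ℤ f (n ∸ e) else + 0

mulSeriesCoeff-polyNeg : ∀ P f n → mulSeriesCoeff (polyNeg P) f n ≡ - mulSeriesCoeff P f n
mulSeriesCoeff-polyNeg []            f n = refl
mulSeriesCoeff-polyNeg ((c , e) ∷ P) f n = begin
  mulSeriesCoeff ((- c , e) ∷ polyNeg P) f n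
    ≡⟨ mulSeriesCoeff-∷ (- c) e (polyNeg P) f n ⟩
  - c *ℤ shift e f n +ℤ mulSeriesCoeff (polyNeg P) f n
    ≡⟨ cong (- c *ℤ shift e f n +ℤ_) (mulSeriesCoeff-polyNeg P f n) ⟩
  - c *ℤ shift e f n +ℤ - mulSeriesCoeff P f n
    ≡⟨ neg-distrib c (shift e f n) (mulSeriesCoeff P f n) ⟩
  - (c *ℤ shift e f n +ℤ mulSeriesCoeff P f n)
    ≡⟨ cong -_ (mulSeriesCoeff-∷ c e P f n) ⟨
  - mulSeriesCoeff ((c , e) ∷ P) f n
    ∎
  where
  open ≡-Reasoning
  neg-distrib : ∀ c x y → - c *ℤ x +ℤ - y ≡ - (c *ℤ x +ℤ y)
  neg-distrib = ℤ-Solver.solve-∀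

mulSeriesCoeff-+ : ∀ P f g n →
  mulSeriesCoeff P (λ m → f m +ℤ g m) n ≡ mulSeriesCoeff P f n +ℤ mulSeriesCoeff P g n
mulSeriesCoeff-+ []            f g n = refl
mulSeriesCoeff-+ ((c , e) ∷ P) f g n
  rewrite mulSeriesCoeff-∷ c e P (λ m → f m +ℤ g m) n | mulSeriesCoeff-∷ c e P f n
        | mulSeriesCoeff-∷ c e P g n | shift-+ e f g n | mulSeriesCoeff-+ P f g n
  = distrib c (shift e f n) (shift e g n) (mulSeriesCoeff P f n) (mulSeriesCoeff P g n)
  where
  distrib : ∀ c x y u v → c *ℤ (x +ℤ y) +ℤ (u +ℤ v) ≡ c *ℤ x +ℤ u +ℤ (c *ℤ y +ℤ v)
  distrib = ℤ-Solver.solve-∀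

mulSeriesCoeff-shift : ∀ P e f n → mulSeriesCoeff P (shift e f) n ≡ shift e (mulSeriesCoeff P f) n
mulSeriesCoeff-shift []             e f n = sym (shift-map e (λ _ → + 0) refl f n)
mulSeriesCoeff-shift ((c , e′) ∷ P) e f n = begin
  mulSeriesCoeff ((c , e′) ∷ P) (shift e f) n
    ≡⟨ mulSeriesCoeff-∷ c e′ P (shift e f) n ⟩
  c *ℤ shift e′ (shift e f) n +ℤ mulSeriesCoeff P (shift e f) n
    ≡⟨ cong₂ (λ x y → c *ℤ x +ℤ y) (shift-comm e′ e f n) (mulSeriesCoeff-shift P e f n) ⟩
  c *ℤ shift e (shift e′ f) n +ℤ shift e (mulSeriesCoeff P f) n
    ≡⟨ cong (_+ℤ shift e (mulSeriesCoeff P f) n) (shift-map e (c *ℤ_) (ℤ.*-zeroʳ c) (shift e′ f) n) ⟨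
  shift e (λ m → c *ℤ shift e′ f m) n +ℤ shift e (mulSeriesCoeff P f) n
    ≡⟨ shift-+ e (λ m → c *ℤ shift e′ f m) (mulSeriesCoeff P f) n ⟨
  shift e (λ m → c *ℤ shift e′ f m +ℤ mulSeriesCoeff P f m) n
    ≡⟨ shift-cong e (λ m → mulSeriesCoeff-∷ c e′ P f m) n ⟨
  shift e (mulSeriesCoeff ((c , e′) ∷ P) f) n
    ∎
  where open ≡-Reasoning

polyCoeff-δ : ∀ P n → polyCoeff P n ≡ mulSeriesCoeff P δ n
polyCoeff-δ []            n = refl
polyCoeff-δ ((c , e) ∷ P) n =
  trans (cong₂ _+ℤ_ (term e n) (polyCoeff-δ P n)) (sym (mulSeriesCoeff-∷ c e P δ n))
  where
  term : ∀ e n → (if e ≡ᵇ n then c else + 0) ≡ c *ℤ shift e δ n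
  term zero    zero    = sym (ℤ.*-identityʳ c)
  term zero    (suc n) = sym (ℤ.*-zeroʳ c)
  term (suc e) zero    = sym (ℤ.*-zeroʳ c)
  term (suc e) (suc n) = term e n

shiftSum : Poly → (ℕ → ℤ) → ℕ → ℤ
shiftSum []            f n = + 0
shiftSum ((c , e) ∷ P) f n = c *ℤ shift e f n +ℤ shiftSum P f n

mulSeriesCoeff-shiftSum : ∀ P f n → mulSeriesCoeff P f n ≡ shiftSum P f n
mulSeriesCoeff-shiftSum []            f n = refl
mulSeriesCoeff-shiftSum ((c , e) ∷ P) f n =
  trans (mulSeriesCoeff-∷ c e P f n) (cong (c *ℤ shift e f n +ℤ_) (mulSeriesCoeff-shiftSum P f n))

shiftSum-polyNeg : ∀ P f n → shiftSum (polyNeg P) f n ≡ - mulSeriesCoeff P f n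
shiftSum-polyNeg P f n =
  trans (sym (mulSeriesCoeff-shiftSum (polyNeg P) f n)) (mulSeriesCoeff-polyNeg P f n)

sumTerms-suc : ∀ r s m →
  sumTerms r s (suc m) ≡ sumTerms r s m ++ (+ 1 , suc m + ceilDiv (suc m * s) r) ∷ []
sumTerms-suc r s m = begin
  map term (map suc (upTo (suc m)))           ≡⟨ cong (map term ∘ map suc) (upTo-∷ʳ m) ⟨
  map term (map suc (upTo m ++ m ∷ []))       ≡⟨ cong (map term) (map-++ suc (upTo m) (m ∷ [])) ⟩
  map term (map suc (upTo m) ++ suc m ∷ [])   ≡⟨ map-++ term (map suc (upTo m)) (suc m ∷ []) ⟩
  map term (map suc (upTo m)) ++ term (suc m) ∷ [] ∎
  where
  open ≡-Reasoning
  term : ℕ → ℤ × ℕ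
  term k = (+ 1 , k + ceilDiv (k * s) r)

mulSeriesCoeff-sumTerms-suc : ∀ r s m f n → mulSeriesCoeff (sumTerms r s (suc m)) f n
  ≡ mulSeriesCoeff (sumTerms r s m) f n +ℤ shift (suc m + ceilDiv (suc m * s) r) f n
mulSeriesCoeff-sumTerms-suc r s m f n = begin
  mulSeriesCoeff (sumTerms r s (suc m)) f n
    ≡⟨ cong (λ P → mulSeriesCoeff P f n) (sumTerms-suc r s m) ⟩
  mulSeriesCoeff (sumTerms r s m ++ (+ 1 , e) ∷ []) f n
    ≡⟨ mulSeriesCoeff-++ (sumTerms r s m) ((+ 1 , e) ∷ []) f n ⟩
  mulSeriesCoeff (sumTerms r s m) f n +ℤ mulSeriesCoeff ((+ 1 , e) ∷ []) f n
    ≡⟨ cong (mulSeriesCoeff (sumTerms r s m) f n +ℤ_) (mulSeriesCoeff-shiftSum ((+ 1 , e) ∷ []) f n) ⟩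
  mulSeriesCoeff (sumTerms r s m) f n +ℤ (+ 1 *ℤ shift e f n +ℤ + 0)
    ≡⟨ cong (mulSeriesCoeff (sumTerms r s m) f n +ℤ_) (unit (shift e f n)) ⟩
  mulSeriesCoeff (sumTerms r s m) f n +ℤ shift e f n
    ∎
  where
  open ≡-Reasoning
  e = suc m + ceilDiv (suc m * s) r
  unit : ∀ x → + 1 *ℤ x +ℤ + 0 ≡ x
  unit = ℤ-Solver.solve-∀

module _ (r s : ℕ) where
  private
    T = mulSeriesCoeff (sumTerms r s r)

  den1-expand : ∀ f n → mulSeriesCoeff (den1 r s) f n
    ≡ f n -ℤ shift 1 f n -ℤ shift (r + s) f n +ℤ shift (suc (r + s)) f n -ℤ T f n
  den1-expand f n = begin
    mulSeriesCoeff (P₄ ++ polyNeg (sumTerms r s r)) f n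
      ≡⟨ mulSeriesCoeff-++ P₄ (polyNeg (sumTerms r s r)) f n ⟩
    mulSeriesCoeff P₄ f n +ℤ mulSeriesCoeff (polyNeg (sumTerms r s r)) f n
      ≡⟨ cong₂ _+ℤ_ (mulSeriesCoeff-shiftSum P₄ f n) (mulSeriesCoeff-polyNeg (sumTerms r s r) f n) ⟩
    shiftSum P₄ f n +ℤ - T f n
      ≡⟨ rearrange (f n) (shift 1 f n) (shift (r + s) f n) (shift (suc (r + s)) f n) (T f n) ⟩
    f n -ℤ shift 1 f n -ℤ shift (r + s) f n +ℤ shift (suc (r + s)) f n -ℤ T f n
      ∎
    where
    open ≡-Reasoning
    P₄ = polyMul ((+ 1 , 0) ∷ (- + 1 , 1) ∷ []) ((+ 1 , 0) ∷ (- + 1 , r + s) ∷ [])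
    rearrange : ∀ a b c d t →
      + 1 *ℤ + 1 *ℤ a +ℤ (+ 1 *ℤ - + 1 *ℤ c +ℤ (- + 1 *ℤ + 1 *ℤ b +ℤ (- + 1 *ℤ - + 1 *ℤ d +ℤ + 0)))
        +ℤ - t ≡ a -ℤ b -ℤ c +ℤ d -ℤ t
    rearrange = ℤ-Solver.solve-∀

  num1-expand : ∀ f n → mulSeriesCoeff (num1 r s) f n ≡ f n -ℤ shift (r + s) f n -ℤ T f n
  num1-expand f n = begin
    mulSeriesCoeff (num1 r s) f n
      ≡⟨ mulSeriesCoeff-shiftSum (num1 r s) f n ⟩
    shiftSum (num1 r s) f n
      ≡⟨ cong (λ x → + 1 *ℤ f n +ℤ (- + 1 *ℤ shift (r + s) f n +ℤ x))
              (shiftSum-polyNeg (sumTerms r s r) f n) ⟩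
    + 1 *ℤ f n +ℤ (- + 1 *ℤ shift (r + s) f n +ℤ - T f n)
      ≡⟨ rearrange (f n) (shift (r + s) f n) (T f n) ⟩
    f n -ℤ shift (r + s) f n -ℤ T f n
      ∎
    where
    open ≡-Reasoning
    rearrange : ∀ a c t → + 1 *ℤ a +ℤ (- + 1 *ℤ c +ℤ - t) ≡ a -ℤ c -ℤ t
    rearrange = ℤ-Solver.solve-∀

  private
    T′ = mulSeriesCoeff (sumTerms r s (r ∸ 1))

  den2-expand : ∀ f n → mulSeriesCoeff (den2 r s) f n
    ≡ f n -ℤ shift 1 f n -ℤ + 2 *ℤ shift (r + s) f n +ℤ shift (suc (r + s)) f n -ℤ T′ f n
  den2-expand f n = begin
    mulSeriesCoeff (den2 r s) f n
      ≡⟨ mulSeriesCoeff-shiftSum (den2 r s) f n ⟩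
    shiftSum (den2 r s) f n
      ≡⟨ cong₂ (λ e x → + 1 *ℤ f n +ℤ (- + 1 *ℤ shift 1 f n +ℤ (- + 2 *ℤ shift (r + s) f n
                        +ℤ (+ 1 *ℤ shift e f n +ℤ x))))
               (+-comm (r + s) 1) (shiftSum-polyNeg (sumTerms r s (r ∸ 1)) f n) ⟩
    + 1 *ℤ f n +ℤ (- + 1 *ℤ shift 1 f n +ℤ (- + 2 *ℤ shift (r + s) f n
      +ℤ (+ 1 *ℤ shift (suc (r + s)) f n +ℤ - T′ f n)))
      ≡⟨ rearrange (f n) (shift 1 f n) (shift (r + s) f n) (shift (suc (r + s)) f n) (T′ f n) ⟩
    f n -ℤ shift 1 f n -ℤ + 2 *ℤ shift (r + s) f n +ℤ shift (suc (r + s)) f n -ℤ T′ f n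
      ∎
    where
    open ≡-Reasoning
    rearrange : ∀ a b c d t →
      + 1 *ℤ a +ℤ (- + 1 *ℤ b +ℤ (- + 2 *ℤ c +ℤ (+ 1 *ℤ d +ℤ - t)))
        ≡ a -ℤ b -ℤ + 2 *ℤ c +ℤ d -ℤ t
    rearrange = ℤ-Solver.solve-∀

  num2-expand : ∀ f n → mulSeriesCoeff (num2 r s) f n ≡ f n -ℤ + 2 *ℤ shift (r + s) f n -ℤ T′ f n
  num2-expand f n = begin
    mulSeriesCoeff (num2 r s) f n
      ≡⟨ mulSeriesCoeff-shiftSum (num2 r s) f n ⟩
    shiftSum (num2 r s) f n
      ≡⟨ cong (λ x → + 1 *ℤ f n +ℤ (- + 2 *ℤ shift (r + s) f n +ℤ x))
              (shiftSum-polyNeg (sumTerms r s (r ∸ 1)) f n) ⟩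
    + 1 *ℤ f n +ℤ (- + 2 *ℤ shift (r + s) f n +ℤ - T′ f n)
      ≡⟨ rearrange (f n) (shift (r + s) f n) (T′ f n) ⟩
    f n -ℤ + 2 *ℤ shift (r + s) f n -ℤ T′ f n
      ∎
    where
    open ≡-Reasoning
    rearrange : ∀ a c t → + 1 *ℤ a +ℤ (- + 2 *ℤ c +ℤ - t) ≡ a -ℤ + 2 *ℤ c -ℤ t
    rearrange = ℤ-Solver.solve-∀

  num1-via-den1 : ∀ f n →
    mulSeriesCoeff (num1 r s) f n ≡ mulSeriesCoeff (den1 r s) f n +ℤ shift 1 f n -ℤ shift (suc (r + s)) f n
  num1-via-den1 f n
    rewrite num1-expand f n | den1-expand f n
    = rearrange (f n) (shift 1 f n) (shift (r + s) f n) (shift (suc (r + s)) f n) (T f n)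
    where
    rearrange : ∀ a b c d t → a -ℤ c -ℤ t ≡ a -ℤ b -ℤ c +ℤ d -ℤ t +ℤ b -ℤ d
    rearrange = ℤ-Solver.solve-∀

module _ (r′ s : ℕ) where
  private
    r = suc r′

  sumTerms-last : ∀ f n → mulSeriesCoeff (sumTerms r s r) f n
    ≡ mulSeriesCoeff (sumTerms r s r′) f n +ℤ shift (r + s) f n
  sumTerms-last f n =
    trans (mulSeriesCoeff-sumTerms-suc r s r′ f n)
          (cong (λ k → mulSeriesCoeff (sumTerms r s r′) f n +ℤ shift (r + k) f n) (ceilDiv-*ˡ r′ s))

  den2≡den1 : ∀ f n → mulSeriesCoeff (den2 r s) f n ≡ mulSeriesCoeff (den1 r s) f n
  den2≡den1 f n
    rewrite den2-expand r s f n | den1-expand r s f n | sumTerms-last f n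
    = rearrange (f n) (shift 1 f n) (shift (r + s) f n) (shift (suc (r + s)) f n)
                (mulSeriesCoeff (sumTerms r s r′) f n)
    where
    rearrange : ∀ a b c d t → a -ℤ b -ℤ + 2 *ℤ c +ℤ d -ℤ t ≡ a -ℤ b -ℤ c +ℤ d -ℤ (t +ℤ c)
    rearrange = ℤ-Solver.solve-∀

  num2≡num1 : ∀ f n → mulSeriesCoeff (num2 r s) f n ≡ mulSeriesCoeff (num1 r s) f n
  num2≡num1 f n
    rewrite num2-expand r s f n | num1-expand r s f n | sumTerms-last f n
    = rearrange (f n) (shift (r + s) f n) (mulSeriesCoeff (sumTerms r s r′) f n)
    where
    rearrange : ∀ a c t → a -ℤ + 2 *ℤ c -ℤ t ≡ a -ℤ c -ℤ (t +ℤ c)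
    rearrange = ℤ-Solver.solve-∀

module CountingSeries (r′ s′ : ℕ) where
  r = suc r′
  s = suc s′
  open Completions r s

  threshold : ℕ → ℕ
  threshold p = ceilDiv (p * s) r

  threshold-pos : ∀ p → 0 < threshold (suc p)
  threshold-pos p = ceilDiv-pos (s′ + p * s) r′

  threshold-mono : ∀ p → threshold p ≤ threshold (suc p)
  threshold-mono p = ceilDiv-monoˡ-≤ r (m≤n+m (p * s) s)

  threshold-periodic : ∀ p → threshold (p + r) ≡ threshold p + s
  threshold-periodic p = begin
    ceilDiv ((p + r) * s) r     ≡⟨ cong (λ a → ceilDiv a r) (*-distribʳ-+ s p r) ⟩
    ceilDiv (p * s + r * s) r   ≡⟨ cong (λ a → ceilDiv (p * s + a) r) (*-comm r s) ⟩
    ceilDiv (p * s + s * r) r   ≡⟨ ceilDiv-+-* (p * s) s r′ ⟩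
    threshold p + s             ∎
    where open ≡-Reasoning

  threshold-zero : threshold 0 ≡ 0
  threshold-zero = ceilDiv-zero r

  threshold-0≤1 : threshold 0 ≤ 1
  threshold-0≤1 = ≤-trans (≤-reflexive threshold-zero) z≤n

  meets-start : meets 0 0 ≡ true
  meets-start = cong (_≤ᵇ 0) threshold-zero

  -- A closed run whose DU-part already meets the threshold leaves no constraint behind.
  completions-reset : ∀ j p v → threshold p ≤ suc v → completions p (suc v) j ≡ completions 0 0 j
  completions-reset zero p v met = begin
    completions p (suc v) 0      ≡⟨ completions-zero p (suc v) ⟩
    indicator (meets p (suc v))  ≡⟨ cong indicator (dec-true (threshold p ≤? suc v) met) ⟩
    1                            ≡⟨ cong indicator meets-start ⟨
    indicator (meets 0 0)        ≡⟨ completions-zero 0 0 ⟨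
    completions 0 0 0            ∎
    where open ≡-Reasoning
  completions-reset (suc j) p v met = begin
    completions p (suc v) (suc j)
      ≡⟨ completions-suc-closed p v j ⟩
    (if meets p (suc v) then completions 1 0 j else 0) + completions p (suc (suc v)) j
      ≡⟨ cong₂ (λ b k → (if b then completions 1 0 j else 0) + k)
               (dec-true (threshold p ≤? suc v) met) (completions-reset j p (suc v) (m≤n⇒m≤1+n met)) ⟩
    completions 1 0 j + completions 0 0 j
      ≡⟨ cong (λ k → completions 1 0 j + k) (completions-reset j 0 0 threshold-0≤1) ⟨
    completions 1 0 j + completions 0 1 j
      ≡⟨ completions-suc-open 0 j ⟨
    completions 0 0 (suc j)
      ∎
    where open ≡-Reasoning

  -- F j and G p j count the completions of length 2j+1 of the initial state and of the state
  -- just after a UD-run of length p, before its DU-run has started.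
  F : ℕ → ℤ
  F j = + completions 0 0 j

  G : ℕ → ℕ → ℤ
  G p j = + completions p 0 j

  meets-short : ∀ {p v d} → suc v + suc d ≡ threshold p → meets p (suc v) ≡ false
  meets-short {p} {v} {d} eq =
    dec-false (threshold p ≤? suc v) (<⇒≱ (subst (suc v <_) eq (m<m+n (suc v) (s≤s z≤n))))

  -- A DU-run d steps short of its threshold forces d more DU factors, after which the state resets.
  completions-deficit : ∀ d j p v → suc v + d ≡ threshold p → + completions p (suc v) j ≡ shift d F j
  completions-deficit zero    j       p v eq =
    cong +_ (completions-reset j p v (≤-reflexive (trans (sym eq) (+-identityʳ (suc v)))))
  completions-deficit (suc d) zero    p v eq =
    cong +_ (trans (completions-zero p (suc v)) (cong indicator (meets-short {p} eq)))
  completions-deficit (suc d) (suc j) p v eq = begin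
    + completions p (suc v) (suc j)
      ≡⟨ cong +_ (completions-suc-closed p v j) ⟩
    + ((if meets p (suc v) then completions 1 0 j else 0) + completions p (suc (suc v)) j)
      ≡⟨ cong (λ b → + ((if b then completions 1 0 j else 0) + completions p (suc (suc v)) j))
              (meets-short {p} eq) ⟩
    + completions p (suc (suc v)) j
      ≡⟨ completions-deficit d j p (suc v) (trans (sym (+-suc (suc v) d)) eq) ⟩
    shift d F j
      ∎
    where open ≡-Reasoning

  G-start : ∀ p → G (suc p) 0 ≡ + 0
  G-start p = cong +_ (trans (completions-zero (suc p) 0)
                             (cong indicator (dec-false (threshold (suc p) ≤? 0) (<⇒≱ (threshold-pos p)))))

  G-step : ∀ p j → G (suc p) j ≡ shift (threshold (suc p)) F j +ℤ shift 1 (G (suc (suc p))) j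
  G-step p zero    = trans (G-start p) (cong (_+ℤ + 0) (sym (shift-below (threshold (suc p)) F (threshold-pos p))))
  G-step p (suc j) = begin
    + completions (suc p) 0 (suc j)
      ≡⟨ cong +_ (completions-suc-open (suc p) j) ⟩
    + (completions (suc (suc p)) 0 j + completions (suc p) 1 j)
      ≡⟨ ℤ.pos-+ (completions (suc (suc p)) 0 j) (completions (suc p) 1 j) ⟩
    G (suc (suc p)) j +ℤ + completions (suc p) 1 j
      ≡⟨ cong (G (suc (suc p)) j +ℤ_)
              (completions-deficit (t ∸ 1) j (suc p) 0 (m+[n∸m]≡n (threshold-pos p))) ⟩
    G (suc (suc p)) j +ℤ shift (t ∸ 1) F j
      ≡⟨ ℤ.+-comm (G (suc (suc p)) j) (shift (t ∸ 1) F j) ⟩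
    shift (t ∸ 1) F j +ℤ G (suc (suc p)) j
      ≡⟨ cong (_+ℤ G (suc (suc p)) j) (shift-suc t F j (threshold-pos p)) ⟨
    shift t F (suc j) +ℤ shift 1 (G (suc (suc p))) (suc j)
      ∎
    where
    open ≡-Reasoning
    t = threshold (suc p)

  G-vanish : ∀ m q → m < threshold (suc q) → G (suc q) m ≡ + 0
  G-vanish zero    q _ = G-start q
  G-vanish (suc m) q m<t = begin
    G (suc q) (suc m)
      ≡⟨ G-step q (suc m) ⟩
    shift (threshold (suc q)) F (suc m) +ℤ G (suc (suc q)) m
      ≡⟨ cong₂ _+ℤ_ (shift-below (threshold (suc q)) F m<t)
                    (G-vanish m (suc q) (<-≤-trans (<-trans (n<1+n m) m<t) (threshold-mono (suc q)))) ⟩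
    + 0
      ∎
    where open ≡-Reasoning

  s<threshold : ∀ p → s < threshold (suc p + r)
  s<threshold p = subst (s <_) (sym (threshold-periodic (suc p))) (+-monoˡ-≤ s (threshold-pos p))

  G-periodic-+ : ∀ m p → G (suc p + r) (m + s) ≡ G (suc p) m
  G-periodic-+ zero    p = trans (G-vanish s (p + r) (s<threshold p)) (sym (G-start p))
  G-periodic-+ (suc m) p = begin
    G (suc p + r) (suc m + s)
      ≡⟨ G-step (p + r) (suc m + s) ⟩
    shift (threshold (suc p + r)) F (suc m + s) +ℤ G (suc (suc p) + r) (m + s)
      ≡⟨ cong₂ _+ℤ_ shifted (G-periodic-+ m (suc p)) ⟩
    shift (threshold (suc p)) F (suc m) +ℤ G (suc (suc p)) m
      ≡⟨ G-step p (suc m) ⟨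
    G (suc p) (suc m)
      ∎
    where
    open ≡-Reasoning
    shifted : shift (threshold (suc p + r)) F (suc m + s) ≡ shift (threshold (suc p)) F (suc m)
    shifted = trans (cong (λ e → shift e F (suc m + s)) (threshold-periodic (suc p)))
                    (shift-+ʳ s (threshold (suc p)) F (suc m))

  G-periodic : ∀ p n → G (suc p + r) n ≡ shift s (G (suc p)) n
  G-periodic p n with n <? s
  ... | yes n<s = trans (G-vanish n (p + r) (<-trans n<s (s<threshold p))) (sym (shift-below s (G (suc p)) n<s))
  ... | no  n≮s = begin
    G (suc p + r) n                 ≡⟨ cong (G (suc p + r)) n∸s+s ⟨
    G (suc p + r) (n ∸ s + s)       ≡⟨ G-periodic-+ (n ∸ s) p ⟩
    G (suc p) (n ∸ s)               ≡⟨ shift-+ʳ s 0 (G (suc p)) (n ∸ s) ⟨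
    shift s (G (suc p)) (n ∸ s + s) ≡⟨ cong (shift s (G (suc p))) n∸s+s ⟩
    shift s (G (suc p)) n           ∎
    where
    open ≡-Reasoning
    n∸s+s : n ∸ s + s ≡ n
    n∸s+s = m∸n+n≡m (≮⇒≥ n≮s)

  G-unroll : ∀ m n → shift 1 (G 1) n ≡ mulSeriesCoeff (sumTerms r s m) F n +ℤ shift (suc m) (G (suc m)) n
  G-unroll zero    n = sym (ℤ.+-identityˡ _)
  G-unroll (suc m) n = begin
    shift 1 (G 1) n
      ≡⟨ G-unroll m n ⟩
    S m +ℤ shift (suc m) (G (suc m)) n
      ≡⟨ cong (S m +ℤ_) (shift-cong (suc m) (G-step m) n) ⟩
    S m +ℤ shift (suc m) (λ j → shift t F j +ℤ shift 1 (G (suc (suc m))) j) n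
      ≡⟨ cong (S m +ℤ_) (shift-+ (suc m) (shift t F) (shift 1 (G (suc (suc m)))) n) ⟩
    S m +ℤ (shift (suc m) (shift t F) n +ℤ shift (suc m) (shift 1 (G (suc (suc m)))) n)
      ≡⟨ cong₂ (λ x y → S m +ℤ (x +ℤ y)) (shift-shift (suc m) t F n)
               (trans (shift-shift (suc m) 1 (G (suc (suc m))) n)
                      (cong (λ e → shift (suc e) (G (suc (suc m))) n) (+-comm m 1))) ⟩
    S m +ℤ (shift (suc m + t) F n +ℤ shift (suc (suc m)) (G (suc (suc m))) n)
      ≡⟨ ℤ.+-assoc (S m) (shift (suc m + t) F n) (shift (suc (suc m)) (G (suc (suc m))) n) ⟨
    S m +ℤ shift (suc m + t) F n +ℤ shift (suc (suc m)) (G (suc (suc m))) n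
      ≡⟨ cong (_+ℤ shift (suc (suc m)) (G (suc (suc m))) n) (mulSeriesCoeff-sumTerms-suc r s m F n) ⟨
    S (suc m) +ℤ shift (suc (suc m)) (G (suc (suc m))) n
      ∎
    where
    open ≡-Reasoning
    S : ℕ → ℤ
    S k = mulSeriesCoeff (sumTerms r s k) F n
    t = threshold (suc m)

  G-series : ∀ n → shift 1 (G 1) n ≡ mulSeriesCoeff (sumTerms r s r) F n +ℤ shift (suc (r + s)) (G 1) n
  G-series n = trans (G-unroll r n)
    (cong (mulSeriesCoeff (sumTerms r s r) F n +ℤ_)
          (trans (shift-cong (suc r) (G-periodic 0) n) (shift-shift (suc r) s (G 1) n)))

  F-step : ∀ n → F n ≡ δ n +ℤ shift 1 F n +ℤ shift 1 (G 1) n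
  F-step zero    = cong +_ (trans (completions-zero 0 0) (cong indicator meets-start))
  F-step (suc j) = begin
    + completions 0 0 (suc j)
      ≡⟨ cong +_ (completions-suc-open 0 j) ⟩
    + (completions 1 0 j + completions 0 1 j)
      ≡⟨ ℤ.pos-+ (completions 1 0 j) (completions 0 1 j) ⟩
    G 1 j +ℤ + completions 0 1 j
      ≡⟨ cong (λ k → G 1 j +ℤ + k) (completions-reset j 0 0 threshold-0≤1) ⟩
    G 1 j +ℤ F j
      ≡⟨ ℤ.+-comm (G 1 j) (F j) ⟩
    F j +ℤ G 1 j
      ≡⟨ cong (_+ℤ G 1 j) (ℤ.+-identityˡ (F j)) ⟨
    + 0 +ℤ F j +ℤ G 1 j
      ∎
    where open ≡-Reasoning

  shift-F-step : ∀ e n → shift e F n ≡ shift e δ n +ℤ shift (suc e) F n +ℤ shift (suc e) (G 1) n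
  shift-F-step e n = begin
    shift e F n
      ≡⟨ shift-cong e F-step n ⟩
    shift e (λ m → δ m +ℤ shift 1 F m +ℤ shift 1 (G 1) m) n
      ≡⟨ shift-+ e (λ m → δ m +ℤ shift 1 F m) (shift 1 (G 1)) n ⟩
    shift e (λ m → δ m +ℤ shift 1 F m) n +ℤ shift e (shift 1 (G 1)) n
      ≡⟨ cong (_+ℤ shift e (shift 1 (G 1)) n) (shift-+ e δ (shift 1 F) n) ⟩
    shift e δ n +ℤ shift e (shift 1 F) n +ℤ shift e (shift 1 (G 1)) n
      ≡⟨ cong₂ (λ x y → shift e δ n +ℤ x +ℤ y) (trans (shift-comm e 1 F n) (shift-shift 1 e F n))
                                                (trans (shift-comm e 1 (G 1) n) (shift-shift 1 e (G 1) n)) ⟩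
    shift e δ n +ℤ shift (suc e) F n +ℤ shift (suc e) (G 1) n
      ∎
    where open ≡-Reasoning

  F-den1 : ∀ n → mulSeriesCoeff (den1 r s) F n ≡ δ n -ℤ shift (r + s) δ n
  F-den1 n = trans (den1-expand r s F n)
                   (eliminate {f₁ = shift 1 F n} {f₃ = shift (suc (r + s)) F n}
                            {t = mulSeriesCoeff (sumTerms r s r) F n} {d = δ n} {d₂ = shift (r + s) δ n}
                            (F-step n) (shift-F-step (r + s) n) (G-series n))
    where
    eliminate : ∀ {f f₁ f₂ f₃ t d d₂ g₁ g₃} →
      f ≡ d +ℤ f₁ +ℤ g₁ → f₂ ≡ d₂ +ℤ f₃ +ℤ g₃ → g₁ ≡ t +ℤ g₃ →
      f -ℤ f₁ -ℤ f₂ +ℤ f₃ -ℤ t ≡ d -ℤ d₂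
    eliminate {f₁ = f₁} {f₃ = f₃} {t} {d} {d₂} {g₃ = g₃} refl refl refl = cancel f₁ f₃ t d d₂ g₃
      where
      cancel : ∀ f₁ f₃ t d d₂ g₃ →
        d +ℤ f₁ +ℤ (t +ℤ g₃) -ℤ f₁ -ℤ (d₂ +ℤ f₃ +ℤ g₃) +ℤ f₃ -ℤ t ≡ d -ℤ d₂
      cancel = ℤ-Solver.solve-∀

  odd≡1+2* : ∀ k → odd k ≡ suc (2 * k)
  odd≡1+2* zero    = refl
  odd≡1+2* (suc k) = cong (suc ∘ suc) (trans (odd≡1+2* k) (sym (+-suc k (k + 0))))

  countR-suc : ∀ k → countR r s (suc k) ≡ completions 0 0 k
  countR-suc k = begin
    count (inR r s) (2 * suc k)
      ≡⟨ cong (count (inR r s)) (trans (*-suc 2 k) (cong suc (sym (odd≡1+2* k)))) ⟩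
    count (inR r s) (suc (odd k))
      ≡⟨ count-suc (inR r s) (odd k) ⟩
    count (inR r s ∘ (U ∷_)) (odd k) + count (λ _ → false) (odd k)
      ≡⟨ cong₂ _+_ (count-cong inR-U (odd k)) (count-false (odd k)) ⟩
    completions 0 0 k + 0
      ≡⟨ +-identityʳ _ ⟩
    completions 0 0 k
      ∎
    where open ≡-Reasoning

  countR-series : ∀ m → + countR r s m ≡ δ m +ℤ shift 1 F m
  countR-series zero    = refl
  countR-series (suc k) = trans (cong +_ (countR-suc k)) (sym (ℤ.+-identityˡ (F k)))

  countR-den1 : ∀ n → mulSeriesCoeff (den1 r s) (λ m → + countR r s m) n ≡ polyCoeff (num1 r s) n
  countR-den1 n = begin
    mulSeriesCoeff Den (λ m → + countR r s m) n
      ≡⟨ mulSeriesCoeff-cong Den countR-series n ⟩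
    mulSeriesCoeff Den (λ m → δ m +ℤ shift 1 F m) n
      ≡⟨ mulSeriesCoeff-+ Den δ (shift 1 F) n ⟩
    mulSeriesCoeff Den δ n +ℤ mulSeriesCoeff Den (shift 1 F) n
      ≡⟨ cong (mulSeriesCoeff Den δ n +ℤ_) (mulSeriesCoeff-shift Den 1 F n) ⟩
    mulSeriesCoeff Den δ n +ℤ shift 1 (mulSeriesCoeff Den F) n
      ≡⟨ cong (mulSeriesCoeff Den δ n +ℤ_) (trans (shift-cong 1 F-den1 n)
                                                (shift-zipWith 1 _-ℤ_ refl δ (shift (r + s) δ) n)) ⟩
    mulSeriesCoeff Den δ n +ℤ (shift 1 δ n -ℤ shift 1 (shift (r + s) δ) n)
      ≡⟨ ℤ.+-assoc (mulSeriesCoeff Den δ n) (shift 1 δ n) (- shift 1 (shift (r + s) δ) n) ⟨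
    mulSeriesCoeff Den δ n +ℤ shift 1 δ n -ℤ shift 1 (shift (r + s) δ) n
      ≡⟨ cong (mulSeriesCoeff Den δ n +ℤ shift 1 δ n -ℤ_) (shift-shift 1 (r + s) δ n) ⟩
    mulSeriesCoeff Den δ n +ℤ shift 1 δ n -ℤ shift (suc (r + s)) δ n
      ≡⟨ num1-via-den1 r s δ n ⟨
    mulSeriesCoeff (num1 r s) δ n
      ≡⟨ polyCoeff-δ (num1 r s) n ⟨
    polyCoeff (num1 r s) n
      ∎
    where
    open ≡-Reasoning
    Den : Poly
    Den = den1 r s

mainTheorem1 : (r s : ℕ) → 0 < r → 0 < s → Coprime r s →
    ((n : ℕ) → mulSeriesCoeff (den1 r s) (λ m → + countR r s m) n ≡ polyCoeff (num1 r s) n)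
    × ((n : ℕ) → mulSeriesCoeff (den2 r s) (λ m → + countR r s m) n ≡ polyCoeff (num2 r s) n)
mainTheorem1 (suc r′) (suc s′) _ _ _ = countR-den1 , countR-den2
  where
  open CountingSeries r′ s′
  countR-den2 : ∀ n → mulSeriesCoeff (den2 r s) (λ m → + countR r s m) n ≡ polyCoeff (num2 r s) n
  countR-den2 n = begin
    mulSeriesCoeff (den2 r s) (λ m → + countR r s m) n ≡⟨ den2≡den1 r′ s (λ m → + countR r s m) n ⟩
    mulSeriesCoeff (den1 r s) (λ m → + countR r s m) n ≡⟨ countR-den1 n ⟩
    polyCoeff (num1 r s) n                             ≡⟨ polyCoeff-δ (num1 r s) n ⟩
    mulSeriesCoeff (num1 r s) δ n                      ≡⟨ num2≡num1 r′ s δ n ⟨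
    mulSeriesCoeff (num2 r s) δ n                      ≡⟨ polyCoeff-δ (num2 r s) n ⟨
    polyCoeff (num2 r s) n                             ∎
    where open ≡-Reasoning
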